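{- Let $\mathcal{T}$ be a finite rooted tree with $q$ leaves, and let $\gamma$ be an integer with $2 \le \gamma \le q$. Then $\mathrm{height}_\gamma(\mathcal{T}) \le \log_\gamma q$.
   Context: For an integer $\gamma \ge 1$ and a node $v$ of a rooted tree, the $\gamma$-height $\mathrm{height}_\gamma(v)$ is defined recursively: if $v$ is a leaf, $\mathrm{height}_\gamma(v)=0$. If $v$ is an internal node, let $g$ be the maximum $\gamma$-height of a child of $v$; if $v$ has fewer than $\gamma$ children of $\gamma$-height equal to $g$, then $\mathrm{height}_\gamma(v)=g$, otherwise $\mathrm{height}_\gamma(v)=g+1$. The $\gamma$-height of a tree, $\mathrm{height}_\gamma(\mathcal{T})$, is the $\gamma$-height of its root. -}

module Defs where

open import Data.Nat using (ℕ; zero; suc; _+_; _⊔_; _<ᵇ_)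
open import Data.Nat.Properties using (_≟_)
open import Data.List using (List; []; _∷_; map; length; filter)
open import Data.Bool using (if_then_else_)

data Tree : Set where
  node : List Tree → Tree

mutual
  leaves : Tree → ℕ
  leaves (node []) = 1
  leaves (node (t ∷ ts)) = leavesList (t ∷ ts)

  leavesList : List Tree → ℕ
  leavesList [] = 0
  leavesList (t ∷ ts) = leaves t + leavesList ts

-- maximum of a list of naturals (0 for the empty list; only used on non-empty lists)
maxList : List ℕ → ℕ
maxList [] = 0
maxList (x ∷ xs) = x ⊔ maxList xs

countEq : ℕ → List ℕ → ℕ
countEq g xs = length (filter (λ x → x ≟ g) xs)

heightStep : ℕ → List ℕ → ℕ
heightStep γ hs =
  let g = maxList hs in
  if countEq g hs <ᵇ γ then g else suc g

mutual
  height : ℕ → Tree → ℕ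
  height γ (node []) = 0
  height γ (node (t ∷ ts)) = heightStep γ (heightList γ (t ∷ ts))

  heightList : ℕ → List Tree → List ℕ
  heightList γ [] = []
  heightList γ (t ∷ ts) = height γ t ∷ heightList γ ts

module Submission where

-- The argument is a weight count: give a
-- node of γ-height h the weight γ ^ h.  For the heights hs of the children
-- of a node, the weight of the node is bounded by the total weight
--   powerSum γ hs = Σ γ ^ h  over h ∈ hs :
--   * if the height equals the maximum g of hs, because g itself occurs in hs;
--   * if the height is g + 1, because at least γ children have height g,
--     so γ ^ (g + 1) = γ * γ ^ g ≤ (number of g's in hs) * γ ^ g ≤ powerSum γ hs.
-- Induction on the tree then gives  γ ^ height γ T ≤ leaves T,  since the
-- leaves of a node are the sum of the leaves of its children.  This holds for
-- every γ.

open import Defs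
open import Data.Nat using (ℕ; _≤_; _^_; _+_; _*_; _<ᵇ_; z≤n)
open import Data.Nat.Properties
  using (_≟_; ≤-refl; ≤-trans; ≮⇒≥; <⇒<ᵇ; ⊔-sel; ⊔-identityʳ;
         m≤m+n; m≤n+m; +-monoʳ-≤; +-mono-≤; *-monoˡ-≤)
open import Data.List using (List; []; _∷_)
open import Data.List.Properties using (filter-accept; filter-reject)
open import Data.List.Membership.Propositional using (_∈_)
open import Data.List.Relation.Unary.Any using (here; there)
open import Data.Bool using (true; false; T)
open import Data.Sum using (inj₁; inj₂)
open import Relation.Nullary using (yes; no)
open import Relation.Binary.PropositionalEquality using (_≡_; refl; sym; subst)

powerSum : ℕ → List ℕ → ℕ
powerSum γ [] = 0
powerSum γ (h ∷ hs) = γ ^ h + powerSum γ hs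

maxList-∈ : ∀ x xs → maxList (x ∷ xs) ∈ x ∷ xs
maxList-∈ x [] = here (⊔-identityʳ x)
maxList-∈ x (y ∷ ys) with ⊔-sel x (maxList (y ∷ ys))
... | inj₁ x⊔m≡x = here x⊔m≡x
... | inj₂ x⊔m≡m = there (subst (_∈ y ∷ ys) (sym x⊔m≡m) (maxList-∈ y ys))

∈⇒power≤powerSum : ∀ γ {h} hs → h ∈ hs → γ ^ h ≤ powerSum γ hs
∈⇒power≤powerSum γ (h ∷ hs) (here refl) = m≤m+n (γ ^ h) (powerSum γ hs)
∈⇒power≤powerSum γ (h′ ∷ hs) (there h∈hs) =
  ≤-trans (∈⇒power≤powerSum γ hs h∈hs) (m≤n+m (powerSum γ hs) (γ ^ h′))

countEq*power≤powerSum : ∀ γ g hs → countEq g hs * γ ^ g ≤ powerSum γ hs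
countEq*power≤powerSum γ g [] = z≤n
countEq*power≤powerSum γ g (h ∷ hs) with h ≟ g
... | yes refl rewrite filter-accept (_≟ g) {h} {hs} refl =
  +-monoʳ-≤ (γ ^ h) (countEq*power≤powerSum γ g hs)
... | no h≢g rewrite filter-reject (_≟ g) {h} {hs} h≢g =
  ≤-trans (countEq*power≤powerSum γ g hs) (m≤n+m (powerSum γ hs) (γ ^ h))

heightStep-power≤powerSum : ∀ γ h hs → γ ^ heightStep γ (h ∷ hs) ≤ powerSum γ (h ∷ hs)
heightStep-power≤powerSum γ h hs with countEq (maxList (h ∷ hs)) (h ∷ hs) <ᵇ γ in eq
... | true = ∈⇒power≤powerSum γ (h ∷ hs) (maxList-∈ h hs)
... | false = ≤-trans (*-monoˡ-≤ (γ ^ g) γ≤count) (countEq*power≤powerSum γ g (h ∷ hs))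
  where
  g : ℕ
  g = maxList (h ∷ hs)

  -- The test failed, so at least γ children attain the maximum height g.
  γ≤count : γ ≤ countEq g (h ∷ hs)
  γ≤count = ≮⇒≥ (λ count<γ → subst T eq (<⇒<ᵇ count<γ))

mutual
  power-height≤leaves : ∀ γ T → γ ^ height γ T ≤ leaves T
  power-height≤leaves γ (node []) = ≤-refl
  power-height≤leaves γ (node (t ∷ ts)) =
    ≤-trans (heightStep-power≤powerSum γ (height γ t) (heightList γ ts))
            (powerSum-heights≤leavesList γ (t ∷ ts))

  powerSum-heights≤leavesList : ∀ γ ts → powerSum γ (heightList γ ts) ≤ leavesList ts
  powerSum-heights≤leavesList γ [] = z≤n
  powerSum-heights≤leavesList γ (t ∷ ts) =
    +-mono-≤ (power-height≤leaves γ t) (powerSum-heights≤leavesList γ ts)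

lemma1 : (T : Tree) (q γ : ℕ) → leaves T ≡ q → 2 ≤ γ → γ ≤ q → γ ^ height γ T ≤ q
lemma1 T q γ refl _ _ = power-height≤leaves γ T
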